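{- Let $h_{state} = \{\mathtt{return}\;x = \lambda s.x,\ \mathit{set}\;x\;k = \lambda s.k\,()\,x,\ \mathit{get}\;x\;k = \lambda s.k\,s\,s\}$ and $c_{ex5} = \mathtt{let}\;g = (\mathtt{with}\;h_{state}\;\mathtt{handle}\;\mathtt{let}\;f = \lambda x.\mathit{get}\,()\,()\;\mathtt{in}\;(\mathit{set}\;f;\;f\,()))\;\mathtt{in}\;g\,(\lambda x.())$. Then $c_{ex5}$ contains no subterm of the form $\mathtt{rec}\;x=v$; it is $\vdash_{\mathrm{st}}$-typable under the simple signature $\Sigma(\mathit{get}) = \mathtt{unit}\to\sigma_t$, $\Sigma(\mathit{set}) = \sigma_t\to\mathtt{unit}$ with $\sigma_t = \mathtt{unit}\to\mathtt{unit}$; it does not terminate (there is an infinite reduction sequence starting from $c_{ex5}$); and it is not $\vdash_{\mathrm{atm}}$-typable under any ATM signature.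
   Context: Syntax. Values $v ::= x \mid () \mid \mathtt{true} \mid \mathtt{false} \mid \lambda x.c \mid \mathtt{rec}\;x = v$; computations $c ::= \mathtt{return}\;v \mid \mathit{op}\;v \mid v_1\,v_2 \mid \mathtt{if}\;v\;\mathtt{then}\;c_1\;\mathtt{else}\;c_2 \mid \mathtt{let}\;x = c_1\;\mathtt{in}\;c_2 \mid \mathtt{with}\;h\;\mathtt{handle}\;c$; handlers $h ::= \{\mathtt{return}\;x = c,\ \mathit{op}_1\,x_1\,k_1 = c_1, \dots\}$. Conventions: a value in computation position means $\mathtt{return}$ of it (e.g.\ $\lambda s.x$ is $\mathtt{return}\,(\lambda s.\mathtt{return}\,x)$ as a clause body); $e_1\,e_2\,e_3$ means $\mathtt{let}\;w=e_1\,e_2\;\mathtt{in}\;w\,e_3$, and a computation in value position is let-bound to a fresh variable first; $c_1;c_2$ means $\mathtt{let}\;z=c_1\;\mathtt{in}\;c_2$ with $z$ fresh. A program is a closed computation. Semantics: evaluation contexts $E ::= [\,] \mid \mathtt{let}\;x = E\;\mathtt{in}\;c$; $\to$ is the least relation with: if $c_1\to c_2$ then $\mathtt{let}\;x=c_1\;\mathtt{in}\;c \to \mathtt{let}\;x=c_2\;\mathtt{in}\;c$; $\mathtt{let}\;x=\mathtt{return}\;v\;\mathtt{in}\;c \to c[v/x]$; $(\lambda x.c)\,v \to c[v/x]$; $(\mathtt{rec}\;x=v)\,v' \to v[(\mathtt{rec}\;x=v)/x]\,v'$; $\mathtt{if}\;\mathtt{true}\;\mathtt{then}\;c_1\;\mathtt{else}\;c_2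 \to c_1$; $\mathtt{if}\;\mathtt{false}\;\ldots \to c_2$; if $c\to c'$ then $\mathtt{with}\;h\;\mathtt{handle}\;c \to \mathtt{with}\;h\;\mathtt{handle}\;c'$; $\mathtt{with}\;h\;\mathtt{handle}\;\mathtt{return}\;v \to c[v/x]$ for the return clause $\mathtt{return}\;x=c$ of $h$; $\mathtt{with}\;h\;\mathtt{handle}\;E[\mathit{op}\;v] \to c[v/x, (\lambda y.\mathtt{with}\;h\;\mathtt{handle}\;E[\mathtt{return}\;y])/k]$ for a clause $\mathit{op}\;x\;k = c$ of $h$. Simple type system $\vdash_{\mathrm{st}}$: types $\sigma ::= \mathtt{unit}\mid\mathtt{bool}\mid\sigma_1\to\sigma_2$; a simple signature assigns each operation a type $\sigma\to\sigma'$. Rules: standard rules for $()$, booleans, variables, $\lambda$ ($\Gamma\vdash\lambda x.c:\sigma\to\sigma'$ if $\Gamma,x:\sigma\vdash c:\sigma'$), $\mathtt{rec}$ ($\Gamma,x:\sigma\vdash v:\sigma$), if, application, let ($\Gamma\vdash c_1:\sigma$, $\Gamma,x:\sigma\vdash c_2:\sigma'$ gives $\sigma'$), $\mathtt{return}\;v:\sigma$ if $v:\sigma$; $\Gamma\vdash\mathit{op}\;v:\sigma'$ if $\Sigma(\mathit{op})=\sigma\to\sigma'$ and $\Gamma\vdash v:\sigma$; $\Gamma\vdash\{\mathtt{return}\;x=c,\overline{\mathit{op}_i\,x_i\,k_i=c_i}\}:\sigma\to\sigma'$ if $\Gamma,x:\sigma\vdash c:\sigma'$ and for each $i$, $\Sigma(\mathit{op}_i)=\sigma_i\to\sigma_i'$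 and $\Gamma,x_i:\sigma_i,k_i:\sigma_i'\to\sigma'\vdash c_i:\sigma'$; $\Gamma\vdash\mathtt{with}\;h\;\mathtt{handle}\;c:\sigma'$ if $\Gamma\vdash h:\sigma\to\sigma'$ and $\Gamma\vdash c:\sigma$. $c$ is $\vdash_{\mathrm{st}}$-typable if $\vdash_{\mathrm{st}} c:\sigma$ for some $\sigma$. ATM types: $b ::= \mathtt{unit} \mid \mathtt{bool}$; $\tau ::= b \mid \tau \to \rho$; $\rho ::= \tau/\square \mid \tau/\rho_1 \Rightarrow \rho_2$. An ATM signature assigns each operation a type $\tau\to\tau'/\rho_1\Rightarrow\rho_2$. Subtyping $\le$: $b \le b$; $\tau_1\to\rho_1 \le \tau_2\to\rho_2$ if $\tau_2\le\tau_1$, $\rho_1\le\rho_2$; $\tau_1/\square \le \tau_2/\square$ if $\tau_1\le\tau_2$; $\tau_1/\rho_1\Rightarrow\rho_1' \le \tau_2/\rho_2\Rightarrow\rho_2'$ if $\tau_1\le\tau_2$, $\rho_2\le\rho_1$, $\rho_1'\le\rho_2'$; $\tau_1/\square \le \tau_2/\rho_1\Rightarrow\rho_2$ if $\tau_1\le\tau_2$, $\rho_1\le\rho_2$. Typing $\vdash_{\mathrm{atm}}$: $\Gamma\vdash ():\mathtt{unit}$; $\Gamma\vdash\mathtt{true},\mathtt{false}:\mathtt{bool}$; $\Gamma\vdash x:\tau$ if $x:\tau\in\Gamma$; $\Gamma\vdash\lambda x.c:\tau\to\rho$ if $\Gamma,x:\tau\vdash c:\rho$; $\Gamma\vdash\mathtt{rec}\;x=v:\tau$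 if $\Gamma,x:\tau\vdash v:\tau$; if-rule with $\mathtt{bool}$ guard and both branches of type $\rho$; $\Gamma\vdash v_1\,v_2:\rho$ if $\Gamma\vdash v_1:\tau\to\rho$, $\Gamma\vdash v_2:\tau$; $\Gamma\vdash\mathtt{let}\;x=c_1\;\mathtt{in}\;c_2:\tau_2/\square$ if $\Gamma\vdash c_1:\tau_1/\square$, $\Gamma,x:\tau_1\vdash c_2:\tau_2/\square$; $\Gamma\vdash\mathtt{let}\;x=c_1\;\mathtt{in}\;c_2:\tau_2/\rho_2\Rightarrow\rho_1'$ if $\Gamma\vdash c_1:\tau_1/\rho_1\Rightarrow\rho_1'$, $\Gamma,x:\tau_1\vdash c_2:\tau_2/\rho_2\Rightarrow\rho_1$; $\Gamma\vdash\mathtt{return}\;v:\tau/\square$ if $\Gamma\vdash v:\tau$; $\Gamma\vdash\mathit{op}\;v:\tau'/\rho_1\Rightarrow\rho_2$ if $\Sigma(\mathit{op})=\tau\to\tau'/\rho_1\Rightarrow\rho_2$, $\Gamma\vdash v:\tau$; $\Gamma\vdash\{\mathtt{return}\;x=c,\overline{\mathit{op}_i\,x_i\,k_i=c_i}\}$ if for each $i$, $\Sigma(\mathit{op}_i)=\tau_i\to\tau_i'/\rho_i\Rightarrow\rho_i'$ and $\Gamma,x_i:\tau_i,k_i:\tau_i'\to\rho_i\vdash c_i:\rho_i'$; $\Gamma\vdash\mathtt{with}\;h\;\mathtt{handle}\;c:\rho'$ if $\Gamma\vdash h$, $\Gamma\vdash c:\tau/\rho\Rightarrow\rho'$, $\Gamma,x:\tau\vdash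 c':\rho$ for the return clause $\mathtt{return}\;x=c'$ of $h$; subsumption for values and computations. A program $c$ is $\vdash_{\mathrm{atm}}$-typable if $\vdash_{\mathrm{atm}} c:\tau/\square$ for some $\tau$. -}

module Defs where

open import Data.Nat using (ℕ; zero; suc)
open import Data.Fin using (Fin; zero; suc; #_)
open import Data.Vec using (Vec; []; _∷_; lookup)
open import Data.Product using (_×_; _,_; proj₁; proj₂; ∃)
open import Relation.Binary.PropositionalEquality using (_≡_)

-- Syntax (intrinsically scoped de Bruijn indices: a term of type
-- Val n / Comp n has its free variables among Fin n; var zero is the
-- innermost bound variable).

Op : Set
Op = ℕ

get set : Op
get = 0
set = 1

data Val (n : ℕ) : Set
data Comp (n : ℕ) : Set
data Handler (n : ℕ) : Set
data Clauses (n : ℕ) : Set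

data Val n where
  var  : Fin n → Val n
  unit : Val n
  true false : Val n
  lam  : Comp (suc n) → Val n
  rec  : Val (suc n) → Val n

data Comp n where
  ret    : Val n → Comp n
  op     : Op → Val n → Comp n
  app    : Val n → Val n → Comp n
  if     : Val n → Comp n → Comp n → Comp n
  lett   : Comp n → Comp (suc n) → Comp n
  handle : Handler n → Comp n → Comp n

data Handler n where
  handler : Comp (suc n) → Clauses n → Handler n

-- Operation clauses "op x k = c": in c, var zero is k and var (suc zero) is x.
data Clauses n where
  []  : Clauses n
  cl  : Op → Comp (suc (suc n)) → Clauses n → Clauses n

data HasClause {n : ℕ} : Clauses n → Op → Comp (suc (suc n)) → Set where
  here  : ∀ {o c cs} → HasClause (cl o c cs) o c
  there : ∀ {o c o' c' cs} → HasClause cs o c → HasClause (cl o' c' cs) o c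

data NoRecV {n : ℕ} : Val n → Set
data NoRecC {n : ℕ} : Comp n → Set
data NoRecH {n : ℕ} : Handler n → Set
data NoRecCl {n : ℕ} : Clauses n → Set

data NoRecV {n} where
  var   : ∀ i → NoRecV (var i)
  unit  : NoRecV unit
  true  : NoRecV true
  false : NoRecV false
  lam   : ∀ {c} → NoRecC c → NoRecV (lam c)

data NoRecC {n} where
  ret    : ∀ {v} → NoRecV v → NoRecC (ret v)
  op     : ∀ {o v} → NoRecV v → NoRecC (op o v)
  app    : ∀ {v w} → NoRecV v → NoRecV w → NoRecC (app v w)
  if     : ∀ {v c d} → NoRecV v → NoRecC c → NoRecC d → NoRecC (if v c d)
  lett   : ∀ {c d} → NoRecC c → NoRecC d → NoRecC (lett c d)
  handle : ∀ {h c} → NoRecH h → NoRecC c → NoRecC (handle h c)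

data NoRecH {n} where
  handler : ∀ {c cs} → NoRecC c → NoRecCl cs → NoRecH (handler c cs)

data NoRecCl {n} where
  []  : NoRecCl []
  cl  : ∀ {o c cs} → NoRecC c → NoRecCl cs → NoRecCl (cl o c cs)

Ren : ℕ → ℕ → Set
Ren n m = Fin n → Fin m

extR : ∀ {n m} → Ren n m → Ren (suc n) (suc m)
extR ρ zero    = zero
extR ρ (suc i) = suc (ρ i)

renV  : ∀ {n m} → Ren n m → Val n → Val m
renC  : ∀ {n m} → Ren n m → Comp n → Comp m
renH  : ∀ {n m} → Ren n m → Handler n → Handler m
renCl : ∀ {n m} → Ren n m → Clauses n → Clauses m

renV ρ (var i)   = var (ρ i)
renV ρ unit      = unit
renV ρ true      = true
renV ρ false     = false
renV ρ (lam c)   = lam (renC (extR ρ) c)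
renV ρ (rec v)   = rec (renV (extR ρ) v)

renC ρ (ret v)      = ret (renV ρ v)
renC ρ (op o v)     = op o (renV ρ v)
renC ρ (app v w)    = app (renV ρ v) (renV ρ w)
renC ρ (if v c d)   = if (renV ρ v) (renC ρ c) (renC ρ d)
renC ρ (lett c d)   = lett (renC ρ c) (renC (extR ρ) d)
renC ρ (handle h c) = handle (renH ρ h) (renC ρ c)

renH ρ (handler c cs) = handler (renC (extR ρ) c) (renCl ρ cs)

renCl ρ []          = []
renCl ρ (cl o c cs) = cl o (renC (extR (extR ρ)) c) (renCl ρ cs)

Sub : ℕ → ℕ → Set
Sub n m = Fin n → Val m

extS : ∀ {n m} → Sub n m → Sub (suc n) (suc m)
extS σ zero    = var zero
extS σ (suc i) = renV suc (σ i)

subV  : ∀ {n m} → Sub n m → Val n → Val m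
subC  : ∀ {n m} → Sub n m → Comp n → Comp m
subH  : ∀ {n m} → Sub n m → Handler n → Handler m
subCl : ∀ {n m} → Sub n m → Clauses n → Clauses m

subV σ (var i)   = σ i
subV σ unit      = unit
subV σ true      = true
subV σ false     = false
subV σ (lam c)   = lam (subC (extS σ) c)
subV σ (rec v)   = rec (subV (extS σ) v)

subC σ (ret v)      = ret (subV σ v)
subC σ (op o v)     = op o (subV σ v)
subC σ (app v w)    = app (subV σ v) (subV σ w)
subC σ (if v c d)   = if (subV σ v) (subC σ c) (subC σ d)
subC σ (lett c d)   = lett (subC σ c) (subC (extS σ) d)
subC σ (handle h c) = handle (subH σ h) (subC σ c)

subH σ (handler c cs) = handler (subC (extS σ) c) (subCl σ cs)

subCl σ []          = []
subCl σ (cl o c cs) = cl o (subC (extS (extS σ)) c) (subCl σ cs)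

sub1 : ∀ {n} → Val n → Sub (suc n) n
sub1 v zero    = v
sub1 v (suc i) = var i

-- [v/x, w/k] where k is var zero and x is var (suc zero)
sub2 : ∀ {n} → Val n → Val n → Sub (suc (suc n)) n
sub2 v w zero          = w
sub2 v w (suc zero)    = v
sub2 v w (suc (suc i)) = var i

data ECtx (n : ℕ) : Set where
  hole : ECtx n
  lett : ECtx n → Comp (suc n) → ECtx n

plug : ∀ {n} → ECtx n → Comp n → Comp n
plug hole       c = c
plug (lett E d) c = lett (plug E c) d

renE : ∀ {n m} → Ren n m → ECtx n → ECtx m
renE ρ hole       = hole
renE ρ (lett E d) = lett (renE ρ E) (renC (extR ρ) d)

infix 4 _⟶_
data _⟶_ {n : ℕ} : Comp n → Comp n → Set where
  let-cong : ∀ {c₁ c₂ c} → c₁ ⟶ c₂ → lett c₁ c ⟶ lett c₂ c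
  let-ret  : ∀ {v c} → lett (ret v) c ⟶ subC (sub1 v) c
  beta     : ∀ {c v} → app (lam c) v ⟶ subC (sub1 v) c
  unfold   : ∀ {v v'} → app (rec v) v' ⟶ app (subV (sub1 (rec v)) v) v'
  if-true  : ∀ {c₁ c₂} → if true c₁ c₂ ⟶ c₁
  if-false : ∀ {c₁ c₂} → if false c₁ c₂ ⟶ c₂
  hdl-cong : ∀ {h c c'} → c ⟶ c' → handle h c ⟶ handle h c'
  hdl-ret  : ∀ {cr cs v} → handle (handler cr cs) (ret v) ⟶ subC (sub1 v) cr
  hdl-op   : ∀ {cr cs E o v c} → HasClause cs o c →
             handle (handler cr cs) (plug E (op o v)) ⟶
             subC (sub2 v (lam (handle (renH suc (handler cr cs))
                                       (plug (renE suc E) (ret (var zero)))))) c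

Diverges : Comp 0 → Set
Diverges c = ∃ λ (f : ℕ → Comp 0) → (f 0 ≡ c) × (∀ i → f i ⟶ f (suc i))

infixr 7 _⇒_
data STy : Set where
  sunit sbool : STy
  _⇒_ : STy → STy → STy

-- a simple signature: op ↦ (σ , σ') meaning op : σ → σ'
SSig : Set
SSig = Op → STy × STy

data _∣_⊢ˢᵛ_∶_ (S : SSig) {n : ℕ} (Γ : Vec STy n) : Val n → STy → Set
data _∣_⊢ˢᶜ_∶_ (S : SSig) {n : ℕ} (Γ : Vec STy n) : Comp n → STy → Set
data _∣_⊢ˢʰ_∶_↝_ (S : SSig) {n : ℕ} (Γ : Vec STy n) : Handler n → STy → STy → Set
data _∣_⊢ˢᶜˡ_∶_ (S : SSig) {n : ℕ} (Γ : Vec STy n) : Clauses n → STy → Set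

data _∣_⊢ˢᵛ_∶_ S {n} Γ where
  unit  : S ∣ Γ ⊢ˢᵛ unit ∶ sunit
  true  : S ∣ Γ ⊢ˢᵛ true ∶ sbool
  false : S ∣ Γ ⊢ˢᵛ false ∶ sbool
  var   : ∀ i → S ∣ Γ ⊢ˢᵛ var i ∶ lookup Γ i
  lam   : ∀ {σ σ' c} → S ∣ σ ∷ Γ ⊢ˢᶜ c ∶ σ' → S ∣ Γ ⊢ˢᵛ lam c ∶ (σ ⇒ σ')
  rec   : ∀ {σ v} → S ∣ σ ∷ Γ ⊢ˢᵛ v ∶ σ → S ∣ Γ ⊢ˢᵛ rec v ∶ σ

data _∣_⊢ˢᶜ_∶_ S {n} Γ where
  ret    : ∀ {σ v} → S ∣ Γ ⊢ˢᵛ v ∶ σ → S ∣ Γ ⊢ˢᶜ ret v ∶ σ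
  op     : ∀ {o v} → S ∣ Γ ⊢ˢᵛ v ∶ proj₁ (S o) → S ∣ Γ ⊢ˢᶜ op o v ∶ proj₂ (S o)
  app    : ∀ {σ σ' v w} → S ∣ Γ ⊢ˢᵛ v ∶ (σ ⇒ σ') → S ∣ Γ ⊢ˢᵛ w ∶ σ →
           S ∣ Γ ⊢ˢᶜ app v w ∶ σ'
  if     : ∀ {σ v c d} → S ∣ Γ ⊢ˢᵛ v ∶ sbool → S ∣ Γ ⊢ˢᶜ c ∶ σ → S ∣ Γ ⊢ˢᶜ d ∶ σ →
           S ∣ Γ ⊢ˢᶜ if v c d ∶ σ
  lett   : ∀ {σ σ' c d} → S ∣ Γ ⊢ˢᶜ c ∶ σ → S ∣ σ ∷ Γ ⊢ˢᶜ d ∶ σ' →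
           S ∣ Γ ⊢ˢᶜ lett c d ∶ σ'
  handle : ∀ {σ σ' h c} → S ∣ Γ ⊢ˢʰ h ∶ σ ↝ σ' → S ∣ Γ ⊢ˢᶜ c ∶ σ →
           S ∣ Γ ⊢ˢᶜ handle h c ∶ σ'

data _∣_⊢ˢʰ_∶_↝_ S {n} Γ where
  handler : ∀ {σ σ' c cs} → S ∣ σ ∷ Γ ⊢ˢᶜ c ∶ σ' → S ∣ Γ ⊢ˢᶜˡ cs ∶ σ' →
            S ∣ Γ ⊢ˢʰ handler c cs ∶ σ ↝ σ'

data _∣_⊢ˢᶜˡ_∶_ S {n} Γ where
  []  : ∀ {σ'} → S ∣ Γ ⊢ˢᶜˡ [] ∶ σ'
  cl  : ∀ {σ' o c cs} →
        S ∣ (proj₂ (S o) ⇒ σ') ∷ proj₁ (S o) ∷ Γ ⊢ˢᶜ c ∶ σ' →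
        S ∣ Γ ⊢ˢᶜˡ cs ∶ σ' → S ∣ Γ ⊢ˢᶜˡ cl o c cs ∶ σ'

data BTy : Set where
  unit bool : BTy

data ATy : Set
data CTy : Set

data ATy where
  base : BTy → ATy
  _⟶ᵃ_ : ATy → CTy → ATy

data CTy where
  _/□ : ATy → CTy
  _/_⇒_ : ATy → CTy → CTy → CTy

record OpTy : Set where
  constructor _⟶_/_⇒_
  field
    arg res : ATy
    pre post : CTy

ASig : Set
ASig = Op → OpTy

infix 4 _≤ᵗ_ _≤ʳ_
data _≤ᵗ_ : ATy → ATy → Set
data _≤ʳ_ : CTy → CTy → Set

data _≤ᵗ_ where
  base : ∀ {b} → base b ≤ᵗ base b
  arr  : ∀ {τ₁ τ₂ ρ₁ ρ₂} → τ₂ ≤ᵗ τ₁ → ρ₁ ≤ʳ ρ₂ → (τ₁ ⟶ᵃ ρ₁) ≤ᵗ (τ₂ ⟶ᵃ ρ₂)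

data _≤ʳ_ where
  pure     : ∀ {τ₁ τ₂} → τ₁ ≤ᵗ τ₂ → (τ₁ /□) ≤ʳ (τ₂ /□)
  eff      : ∀ {τ₁ τ₂ ρ₁ ρ₁' ρ₂ ρ₂'} → τ₁ ≤ᵗ τ₂ → ρ₂ ≤ʳ ρ₁ → ρ₁' ≤ʳ ρ₂' →
             (τ₁ / ρ₁ ⇒ ρ₁') ≤ʳ (τ₂ / ρ₂ ⇒ ρ₂')
  pure-eff : ∀ {τ₁ τ₂ ρ₁ ρ₂} → τ₁ ≤ᵗ τ₂ → ρ₁ ≤ʳ ρ₂ → (τ₁ /□) ≤ʳ (τ₂ / ρ₁ ⇒ ρ₂)

data _∣_⊢ᵃᵛ_∶_ (A : ASig) {n : ℕ} (Γ : Vec ATy n) : Val n → ATy → Set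
data _∣_⊢ᵃᶜ_∶_ (A : ASig) {n : ℕ} (Γ : Vec ATy n) : Comp n → CTy → Set
data _∣_⊢ᵃᶜˡ_ (A : ASig) {n : ℕ} (Γ : Vec ATy n) : Clauses n → Set

data _∣_⊢ᵃᵛ_∶_ A {n} Γ where
  unit  : A ∣ Γ ⊢ᵃᵛ unit ∶ base unit
  true  : A ∣ Γ ⊢ᵃᵛ true ∶ base bool
  false : A ∣ Γ ⊢ᵃᵛ false ∶ base bool
  var   : ∀ i → A ∣ Γ ⊢ᵃᵛ var i ∶ lookup Γ i
  lam   : ∀ {τ ρ c} → A ∣ τ ∷ Γ ⊢ᵃᶜ c ∶ ρ → A ∣ Γ ⊢ᵃᵛ lam c ∶ (τ ⟶ᵃ ρ)
  rec   : ∀ {τ v} → A ∣ τ ∷ Γ ⊢ᵃᵛ v ∶ τ → A ∣ Γ ⊢ᵃᵛ rec v ∶ τ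
  sub   : ∀ {τ τ' v} → A ∣ Γ ⊢ᵃᵛ v ∶ τ → τ ≤ᵗ τ' → A ∣ Γ ⊢ᵃᵛ v ∶ τ'

data _∣_⊢ᵃᶜ_∶_ A {n} Γ where
  if       : ∀ {ρ v c d} → A ∣ Γ ⊢ᵃᵛ v ∶ base bool → A ∣ Γ ⊢ᵃᶜ c ∶ ρ → A ∣ Γ ⊢ᵃᶜ d ∶ ρ →
             A ∣ Γ ⊢ᵃᶜ if v c d ∶ ρ
  app      : ∀ {τ ρ v w} → A ∣ Γ ⊢ᵃᵛ v ∶ (τ ⟶ᵃ ρ) → A ∣ Γ ⊢ᵃᵛ w ∶ τ →
             A ∣ Γ ⊢ᵃᶜ app v w ∶ ρ
  let-pure : ∀ {τ₁ τ₂ c d} → A ∣ Γ ⊢ᵃᶜ c ∶ (τ₁ /□) → A ∣ τ₁ ∷ Γ ⊢ᵃᶜ d ∶ (τ₂ /□) →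
             A ∣ Γ ⊢ᵃᶜ lett c d ∶ (τ₂ /□)
  let-eff  : ∀ {τ₁ τ₂ ρ₁ ρ₁' ρ₂ c d} →
             A ∣ Γ ⊢ᵃᶜ c ∶ (τ₁ / ρ₁ ⇒ ρ₁') → A ∣ τ₁ ∷ Γ ⊢ᵃᶜ d ∶ (τ₂ / ρ₂ ⇒ ρ₁) →
             A ∣ Γ ⊢ᵃᶜ lett c d ∶ (τ₂ / ρ₂ ⇒ ρ₁')
  ret      : ∀ {τ v} → A ∣ Γ ⊢ᵃᵛ v ∶ τ → A ∣ Γ ⊢ᵃᶜ ret v ∶ (τ /□)
  op       : ∀ {o v} → A ∣ Γ ⊢ᵃᵛ v ∶ OpTy.arg (A o) →
             A ∣ Γ ⊢ᵃᶜ op o v ∶ (OpTy.res (A o) / OpTy.pre (A o) ⇒ OpTy.post (A o))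
  handle   : ∀ {τ ρ ρ' cr cs c} → A ∣ Γ ⊢ᵃᶜˡ cs → A ∣ Γ ⊢ᵃᶜ c ∶ (τ / ρ ⇒ ρ') →
             A ∣ τ ∷ Γ ⊢ᵃᶜ cr ∶ ρ → A ∣ Γ ⊢ᵃᶜ handle (handler cr cs) c ∶ ρ'
  sub      : ∀ {ρ ρ' c} → A ∣ Γ ⊢ᵃᶜ c ∶ ρ → ρ ≤ʳ ρ' → A ∣ Γ ⊢ᵃᶜ c ∶ ρ'

data _∣_⊢ᵃᶜˡ_ A {n} Γ where
  []  : A ∣ Γ ⊢ᵃᶜˡ []
  cl  : ∀ {o c cs} →
        A ∣ (OpTy.res (A o) ⟶ᵃ OpTy.pre (A o)) ∷ OpTy.arg (A o) ∷ Γ ⊢ᵃᶜ c ∶ OpTy.post (A o) →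
        A ∣ Γ ⊢ᵃᶜˡ cs → A ∣ Γ ⊢ᵃᶜˡ cl o c cs

-- h_state = {return x = λs.x, set x k = λs.k () x, get x k = λs.k s s}
h-state : Handler 0
h-state = handler
  (ret (lam (ret (var (# 1)))))
  (cl set (ret (lam (lett (app (var (# 1)) unit) (app (var (# 0)) (var (# 3))))))
  (cl get (ret (lam (lett (app (var (# 1)) (var (# 0))) (app (var (# 0)) (var (# 1))))))
  []))

-- let f = λx.get () () in (set f; f ())
c-body : Comp 0
c-body = lett (ret (lam (lett (op get unit) (app (var (# 0)) unit))))
              (lett (op set (var (# 0))) (app (var (# 1)) unit))

-- c_ex5 = let g = (with h_state handle c-body) in g (λx.())
c-ex5 : Comp 0
c-ex5 = lett (handle h-state c-body) (app (var (# 0)) (lam (ret unit)))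

σt : STy
σt = sunit ⇒ sunit

-- Reduction: after `set f` the state is f itself, and running f under the
-- state handler performs `get`, which feeds the state f back to the
-- continuation that calls f again; from c_ex5 one reaches the term
-- (with h_state handle f ()) f, which reduces to itself in six steps.
--
-- ATM types: the get clause λs. k s s forces the state type σ, the
-- argument of the value type of get's post-type, to be accepted by
-- the value type of its pre-type.  Since the state is f, σ is an
-- effectful arrow whose post-type Q lies between get's post- and
-- pre-types, so σ is (up to subtyping in both directions) the argument
-- of the value type of Q, a component of σ itself: no finite type does this.
module Submission where

open import Defs
open import Data.Empty using (⊥; ⊥-elim)
open import Data.Fin using (zero; suc)
open import Data.Nat using (ℕ; zero; suc)
open import Data.Product using (Σ; ∃; ∃₂; _×_; _,_; proj₁; proj₂)
open import Data.Vec using (Vec; []; _∷_; lookup)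
open import Level using (Level)
open import Relation.Binary.Core using (Rel)
open import Relation.Binary.Construct.Closure.Transitive using (TransClosure; [_]; _∷_)
open import Relation.Binary.PropositionalEquality using (_≡_; refl; sym; cong; cong₂; subst)
open import Relation.Nullary using (¬_)

c-ex5-noRec : NoRecC c-ex5
c-ex5-noRec =
  lett (handle (handler (ret (lam (ret (var _))))
                        (cl (ret (lam (lett (app (var _) unit) (app (var _) (var _)))))
                        (cl (ret (lam (lett (app (var _) (var _)) (app (var _) (var _))))) [])))
               (lett (ret (lam (lett (op unit) (app (var _) unit))))
                     (lett (op (var _)) (app (var _) unit))))
       (app (var _) (lam (ret unit)))

module SimpleTyping (S : SSig) where

  ⊢ˢ-op : ∀ {n} {Γ : Vec STy n} {o v σ σ'} → S o ≡ (σ , σ') →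
          S ∣ Γ ⊢ˢᵛ v ∶ σ → S ∣ Γ ⊢ˢᶜ op o v ∶ σ'
  ⊢ˢ-op {Γ = Γ} {o} {v} So d =
    subst (λ s → S ∣ Γ ⊢ˢᶜ op o v ∶ proj₂ s) So
          (op (subst (λ s → S ∣ Γ ⊢ˢᵛ v ∶ proj₁ s) (sym So) d))

  ⊢ˢ-cl : ∀ {n} {Γ : Vec STy n} {o c cs σ σ' τ} → S o ≡ (σ , σ') →
          S ∣ (σ' ⇒ τ) ∷ σ ∷ Γ ⊢ˢᶜ c ∶ τ → S ∣ Γ ⊢ˢᶜˡ cs ∶ τ →
          S ∣ Γ ⊢ˢᶜˡ cl o c cs ∶ τ
  ⊢ˢ-cl {Γ = Γ} {c = c} {τ = τ} So d ds =
    cl (subst (λ s → S ∣ (proj₂ s ⇒ τ) ∷ proj₁ s ∷ Γ ⊢ˢᶜ c ∶ τ) (sym So) d) ds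

  c-ex5-⊢ˢ : S get ≡ (sunit , σt) → S set ≡ (σt , sunit) → S ∣ [] ⊢ˢᶜ c-ex5 ∶ sunit
  c-ex5-⊢ˢ Sget Sset =
    lett {σ = σt ⇒ sunit}
      (handle
        (handler (ret (lam (ret (var _))))
          (⊢ˢ-cl Sset (ret (lam (lett (app (var _) unit) (app (var _) (var _)))))
          (⊢ˢ-cl Sget (ret (lam (lett (app (var _) (var _)) (app (var _) (var _))))) [])))
        (lett {σ = σt} (ret (lam (lett (⊢ˢ-op Sget unit) (app (var _) unit))))
          (lett (⊢ˢ-op Sset (var _)) (app (var _) unit))))
      (app (var _) (lam (ret unit)))

module _ {a ℓ : Level} {A : Set a} {_∼_ : Rel A ℓ} where

  infinite-chain-via-cycle : ∀ {x y} → TransClosure _∼_ y y → TransClosure _∼_ x y →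
                             ∃ λ (f : ℕ → A) → f 0 ≡ x × (∀ i → f i ∼ f (suc i))
  infinite-chain-via-cycle {x} {y} y∼⁺y x∼⁺y =
    (λ i → proj₁ (orbit i)) , refl , λ i → proj₁ (proj₂ (step (proj₂ (orbit i))))
    where
    step : ∀ {z} → TransClosure _∼_ z y → Σ A λ z' → z ∼ z' × TransClosure _∼_ z' y
    step [ z∼y ]        = _ , z∼y , y∼⁺y
    step (z∼z' ∷ z'∼⁺y) = _ , z∼z' , z'∼⁺y

    orbit : ℕ → Σ A λ z → TransClosure _∼_ z y
    orbit zero    = x , x∼⁺y
    orbit (suc i) = let z' , _ , z'∼⁺y = step (proj₂ (orbit i)) in z' , z'∼⁺y

f-get : ∀ {n} → Val n
f-get = lam (lett (op get unit) (app (var zero) unit))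

loop : Comp 0
loop = lett (handle h-state (app f-get unit)) (app (var zero) f-get)

loop⟶⁺loop : TransClosure _⟶_ loop loop
loop⟶⁺loop =
  let-cong (hdl-cong beta)
  ∷ let-cong (hdl-op {E = lett hole (app (var zero) unit)} (there here))
  ∷ let-ret
  ∷ beta
  ∷ let-cong beta
  ∷ [ let-cong (hdl-cong let-ret) ]

c-ex5⟶⁺loop : TransClosure _⟶_ c-ex5 loop
c-ex5⟶⁺loop =
  let-cong (hdl-cong let-ret)
  ∷ let-cong (hdl-op {E = lett hole (app f-get unit)} here)
  ∷ let-ret
  ∷ beta
  ∷ let-cong beta
  ∷ [ let-cong (hdl-cong let-ret) ]

c-ex5-diverges : Diverges c-ex5
c-ex5-diverges = infinite-chain-via-cycle loop⟶⁺loop c-ex5⟶⁺loop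

≤ᵗ-refl : ∀ τ → τ ≤ᵗ τ
≤ʳ-refl : ∀ ρ → ρ ≤ʳ ρ
≤ᵗ-refl (base b) = base
≤ᵗ-refl (τ ⟶ᵃ ρ) = arr (≤ᵗ-refl τ) (≤ʳ-refl ρ)
≤ʳ-refl (τ /□)       = pure (≤ᵗ-refl τ)
≤ʳ-refl (τ / ρ ⇒ ρ') = eff (≤ᵗ-refl τ) (≤ʳ-refl ρ) (≤ʳ-refl ρ')

≤ᵗ-trans : ∀ {τ₁ τ₂ τ₃} → τ₁ ≤ᵗ τ₂ → τ₂ ≤ᵗ τ₃ → τ₁ ≤ᵗ τ₃
≤ʳ-trans : ∀ {ρ₁ ρ₂ ρ₃} → ρ₁ ≤ʳ ρ₂ → ρ₂ ≤ʳ ρ₃ → ρ₁ ≤ʳ ρ₃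
≤ᵗ-trans base       base         = base
≤ᵗ-trans (arr p q)  (arr p' q')  = arr (≤ᵗ-trans p' p) (≤ʳ-trans q q')
≤ʳ-trans (pure p)   (pure q)     = pure (≤ᵗ-trans p q)
≤ʳ-trans (pure p)   (pure-eff q r) = pure-eff (≤ᵗ-trans p q) r
≤ʳ-trans (eff p q r) (eff p' q' r') = eff (≤ᵗ-trans p p') (≤ʳ-trans q' q) (≤ʳ-trans r r')
≤ʳ-trans (pure-eff p r) (eff p' q' r') = pure-eff (≤ᵗ-trans p p') (≤ʳ-trans q' (≤ʳ-trans r r'))

≤ᵗ-antisym : ∀ {τ τ'} → τ ≤ᵗ τ' → τ' ≤ᵗ τ → τ ≡ τ'
≤ʳ-antisym : ∀ {ρ ρ'} → ρ ≤ʳ ρ' → ρ' ≤ʳ ρ → ρ ≡ ρ'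
≤ᵗ-antisym base      base        = refl
≤ᵗ-antisym (arr p q) (arr p' q') = cong₂ _⟶ᵃ_ (≤ᵗ-antisym p' p) (≤ʳ-antisym q q')
≤ʳ-antisym (pure p)  (pure q)    = cong _/□ (≤ᵗ-antisym p q)
≤ʳ-antisym (eff p q r) (eff p' q' r')
  rewrite ≤ᵗ-antisym p p' | ≤ʳ-antisym q' q | ≤ʳ-antisym r r' = refl

valTy : CTy → ATy
valTy (τ /□)      = τ
valTy (τ / _ ⇒ _) = τ

valTy-mono : ∀ {ρ ρ'} → ρ ≤ʳ ρ' → valTy ρ ≤ᵗ valTy ρ'
valTy-mono (pure p)       = p
valTy-mono (eff p _ _)    = p
valTy-mono (pure-eff p _) = p

⟶-post-≤ : ∀ {a t α β a' t' α' β'} →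
           (a ⟶ᵃ (t / α ⇒ β)) ≤ᵗ (a' ⟶ᵃ (t' / α' ⇒ β')) → β ≤ʳ β'
⟶-post-≤ (arr _ (eff _ _ β≤β')) = β≤β'

data EffArrow (q : CTy) : ATy → Set where
  effArrow : ∀ {a t α β} → q ≤ʳ β → EffArrow q (a ⟶ᵃ (t / α ⇒ β))

EffArrow-mono : ∀ {q τ τ'} → EffArrow q τ → τ ≤ᵗ τ' → EffArrow q τ'
EffArrow-mono (effArrow q≤β) (arr _ (eff _ _ β≤β')) = effArrow (≤ʳ-trans q≤β β≤β')

EffArrow-post : ∀ {q τ u t α β} → EffArrow q τ → τ ≤ᵗ (u ⟶ᵃ (t / α ⇒ β)) → q ≤ʳ β
EffArrow-post (effArrow q≤β) τ≤ = ≤ʳ-trans q≤β (⟶-post-≤ τ≤)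

-- σ ≤ u ≤ σ' ≤ σ makes σ equal to its own component σ', which the unifier's cycle check refutes.
no-arrow-fed-to-own-post : ∀ {a t α Q ρ u r} →
  let σ = a ⟶ᵃ (t / α ⇒ Q) in
  (σ ⟶ᵃ ρ) ≤ᵗ valTy Q → valTy Q ≤ᵗ (u ⟶ᵃ r) → σ ≤ᵗ u → ⊥
no-arrow-fed-to-own-post {Q = _ /□} (arr σ'≤σ _) (arr u≤σ' _) σ≤u
  with ≤ᵗ-antisym σ'≤σ (≤ᵗ-trans σ≤u u≤σ')
... | ()
no-arrow-fed-to-own-post {Q = _ / _ ⇒ _} (arr σ'≤σ _) (arr u≤σ' _) σ≤u
  with ≤ᵗ-antisym σ'≤σ (≤ᵗ-trans σ≤u u≤σ')
... | ()

module ATMInversion (A : ASig) where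

  var-inv : ∀ {n} {Γ : Vec ATy n} {i τ} → A ∣ Γ ⊢ᵃᵛ var i ∶ τ → lookup Γ i ≤ᵗ τ
  var-inv (var i)   = ≤ᵗ-refl _
  var-inv (sub d p) = ≤ᵗ-trans (var-inv d) p

  lam-inv : ∀ {n} {Γ : Vec ATy n} {c τ} → A ∣ Γ ⊢ᵃᵛ lam c ∶ τ →
            ∃₂ λ σ ρ → A ∣ σ ∷ Γ ⊢ᵃᶜ c ∶ ρ × (σ ⟶ᵃ ρ) ≤ᵗ τ
  lam-inv (lam d)   = _ , _ , d , ≤ᵗ-refl _
  lam-inv (sub d p) = let σ , ρ , d' , q = lam-inv d in σ , ρ , d' , ≤ᵗ-trans q p

  ret-inv : ∀ {n} {Γ : Vec ATy n} {v ρ} → A ∣ Γ ⊢ᵃᶜ ret v ∶ ρ →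
            ∃ λ τ → A ∣ Γ ⊢ᵃᵛ v ∶ τ × (τ /□) ≤ʳ ρ
  ret-inv (ret d)   = _ , d , ≤ʳ-refl _
  ret-inv (sub d p) = let τ , d' , q = ret-inv d in τ , d' , ≤ʳ-trans q p

  ret-lam-inv : ∀ {n} {Γ : Vec ATy n} {c ρ} → A ∣ Γ ⊢ᵃᶜ ret (lam c) ∶ ρ →
                ∃₂ λ σ ρ' → A ∣ σ ∷ Γ ⊢ᵃᶜ c ∶ ρ' × (σ ⟶ᵃ ρ') ≤ᵗ valTy ρ
  ret-lam-inv d =
    let _ , dλ , τ≤ = ret-inv d
        σ , ρ' , dc , σ⟶ρ'≤τ = lam-inv dλ
    in σ , ρ' , dc , ≤ᵗ-trans σ⟶ρ'≤τ (valTy-mono τ≤)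

  op-inv : ∀ {n} {Γ : Vec ATy n} {o v ρ} → A ∣ Γ ⊢ᵃᶜ op o v ∶ ρ →
           A ∣ Γ ⊢ᵃᵛ v ∶ OpTy.arg (A o) ×
           (OpTy.res (A o) / OpTy.pre (A o) ⇒ OpTy.post (A o)) ≤ʳ ρ
  op-inv (op d)    = d , ≤ʳ-refl _
  op-inv (sub d p) = let d' , q = op-inv d in d' , ≤ʳ-trans q p

  op-not-pure : ∀ {n} {Γ : Vec ATy n} {o v τ} → ¬ (A ∣ Γ ⊢ᵃᶜ op o v ∶ (τ /□))
  op-not-pure d with op-inv d
  ... | _ , ()

  app-var-inv : ∀ {n} {Γ : Vec ATy n} {i w ρ} → A ∣ Γ ⊢ᵃᶜ app (var i) w ∶ ρ →
                ∃ λ u → lookup Γ i ≤ᵗ (u ⟶ᵃ ρ) × A ∣ Γ ⊢ᵃᵛ w ∶ u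
  app-var-inv (app dv dw) = _ , var-inv dv , dw
  app-var-inv (sub d p)   =
    let u , i≤ , dw = app-var-inv d in u , ≤ᵗ-trans i≤ (arr (≤ᵗ-refl u) p) , dw

  data LetTyping {n} (Γ : Vec ATy n) (c : Comp n) (d : Comp (suc n)) (ρ : CTy) : Set where
    pure : ∀ {τ₁ τ₂} → A ∣ Γ ⊢ᵃᶜ c ∶ (τ₁ /□) → A ∣ τ₁ ∷ Γ ⊢ᵃᶜ d ∶ (τ₂ /□) →
           (τ₂ /□) ≤ʳ ρ → LetTyping Γ c d ρ
    eff  : ∀ {τ₁ τ₂ ρ₁ ρ₁' ρ₂} → A ∣ Γ ⊢ᵃᶜ c ∶ (τ₁ / ρ₁ ⇒ ρ₁') →
           A ∣ τ₁ ∷ Γ ⊢ᵃᶜ d ∶ (τ₂ / ρ₂ ⇒ ρ₁) → (τ₂ / ρ₂ ⇒ ρ₁') ≤ʳ ρ → LetTyping Γ c d ρ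

  let-inv : ∀ {n} {Γ : Vec ATy n} {c d ρ} → A ∣ Γ ⊢ᵃᶜ lett c d ∶ ρ → LetTyping Γ c d ρ
  let-inv (let-pure dc dd) = pure dc dd (≤ʳ-refl _)
  let-inv (let-eff dc dd)  = eff dc dd (≤ʳ-refl _)
  let-inv (sub d p) with let-inv d
  ... | pure dc dd q = pure dc dd (≤ʳ-trans q p)
  ... | eff dc dd q  = eff dc dd (≤ʳ-trans q p)

  let-parts : ∀ {n} {Γ : Vec ATy n} {c d ρ} → A ∣ Γ ⊢ᵃᶜ lett c d ∶ ρ →
              ∃₂ λ ρ₁ ρ₂ → A ∣ Γ ⊢ᵃᶜ c ∶ ρ₁ × A ∣ valTy ρ₁ ∷ Γ ⊢ᵃᶜ d ∶ ρ₂
  let-parts d with let-inv d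
  ... | pure dc dd _ = _ , _ , dc , dd
  ... | eff dc dd _  = _ , _ , dc , dd

  handle-inv : ∀ {n} {Γ : Vec ATy n} {cr cs c ρ} → A ∣ Γ ⊢ᵃᶜ handle (handler cr cs) c ∶ ρ →
               A ∣ Γ ⊢ᵃᶜˡ cs × ∃ λ ρ' → A ∣ Γ ⊢ᵃᶜ c ∶ ρ'
  handle-inv (handle dcs dc _) = dcs , _ , dc
  handle-inv (sub d _)         = handle-inv d

  -- let z = k v in z w, where k is the continuation of a clause λs. …
  resume-apply-inv : ∀ {n} {Δ : Vec ATy n} {σ κ p v j ρ} →
    let Γ = σ ∷ (κ ⟶ᵃ p) ∷ Δ in
    A ∣ Γ ⊢ᵃᶜ lett (app (var (suc zero)) v) (app (var zero) (var (suc j))) ∶ ρ →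
    A ∣ Γ ⊢ᵃᵛ v ∶ κ × ∃₂ λ u r → valTy p ≤ᵗ (u ⟶ᵃ r) × lookup Γ j ≤ᵗ u
  resume-apply-inv d with let-parts d
  ... | _ , _ , dkv , dzw with app-var-inv dkv | app-var-inv dzw
  ... | _ , arr u₀≤κ p≤ρ₁ , dv | u , ρ₁≤ , dw =
    sub dv u₀≤κ , u , _ , ≤ᵗ-trans (valTy-mono p≤ρ₁) ρ₁≤ , var-inv dw

module NotATMTypable (A : ASig) where
  open ATMInversion A

  open OpTy (A get) renaming (arg to arg-get; res to res-get; pre to pre-get; post to post-get)
  open OpTy (A set) renaming (arg to arg-set; res to res-set; pre to pre-set; post to post-set)

  f-get-inv : ∀ {n} {Γ : Vec ATy n} {τ} → A ∣ Γ ⊢ᵃᵛ f-get ∶ τ →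
              EffArrow post-get τ ×
              ∃₂ λ u t → ∃₂ λ α β → res-get ≤ᵗ (u ⟶ᵃ (t / α ⇒ β)) × β ≤ʳ pre-get
  f-get-inv d with lam-inv d
  ... | _ , _ , dbody , ≤τ with let-inv dbody
  ... | pure dget _ _ = ⊥-elim (op-not-pure dget)
  ... | eff dget dcall (eff _ _ ρ₁'≤β) with op-inv dget | app-var-inv dcall
  ... | _ , eff res≤τ₁ ρ₁≤pre post≤ρ₁' | _ , τ₁≤ , _ =
    EffArrow-mono (effArrow (≤ʳ-trans post≤ρ₁' ρ₁'≤β)) ≤τ ,
    _ , _ , _ , _ , ≤ᵗ-trans res≤τ₁ τ₁≤ , ρ₁≤pre

  set-f-then-call-inv : ∀ {n} {Δ : Vec ATy n} {τ ρ} → EffArrow post-get τ →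
    A ∣ τ ∷ Δ ⊢ᵃᶜ lett (op set (var zero)) (app (var (suc zero)) unit) ∶ ρ →
    τ ≤ᵗ arg-set × post-get ≤ʳ pre-set
  set-f-then-call-inv τ-post d with let-inv d
  ... | pure dset _ _ = ⊥-elim (op-not-pure dset)
  ... | eff dset dcall _ with op-inv dset | app-var-inv dcall
  ... | dv , eff _ ρ₁≤pre _ | _ , τ≤ , _ = var-inv dv , ≤ʳ-trans (EffArrow-post τ-post τ≤) ρ₁≤pre

  set-clause-inv : ∀ {n} {Γ : Vec ATy n} →
    A ∣ (res-set ⟶ᵃ pre-set) ∷ arg-set ∷ Γ ⊢ᵃᶜ
      ret (lam (lett (app (var (suc zero)) unit) (app (var zero) (var (suc (suc (suc zero))))))) ∶ post-set →
    ∃₂ λ u r → valTy pre-set ≤ᵗ (u ⟶ᵃ r) × arg-set ≤ᵗ u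
  set-clause-inv d =
    let _ , _ , dbody , _ = ret-lam-inv d
        _ , resumed = resume-apply-inv dbody
    in resumed

  get-clause-inv : ∀ {n} {Γ : Vec ATy n} →
    A ∣ (res-get ⟶ᵃ pre-get) ∷ arg-get ∷ Γ ⊢ᵃᶜ
      ret (lam (lett (app (var (suc zero)) (var zero)) (app (var zero) (var (suc zero))))) ∶ post-get →
    ∃₂ λ σ ρ → (σ ⟶ᵃ ρ) ≤ᵗ valTy post-get × σ ≤ᵗ res-get ×
               ∃₂ λ u r → valTy pre-get ≤ᵗ (u ⟶ᵃ r) × σ ≤ᵗ u
  get-clause-inv d =
    let σ , ρ , dbody , σ⟶ρ≤ = ret-lam-inv d
        ds , resumed = resume-apply-inv dbody
    in σ , ρ , σ⟶ρ≤ , var-inv ds , resumed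

  c-ex5-not-typable : ∀ τ → ¬ (A ∣ [] ⊢ᵃᶜ c-ex5 ∶ (τ /□))
  c-ex5-not-typable _ d with let-parts d
  ... | _ , _ , dhandled , _ with handle-inv dhandled
  ... | cl dset (cl dget []) , _ , dbody with let-parts dbody
  ... | ρf , _ , dret , dcont with ret-inv dret
  ... | _ , df , τ≤ρf with f-get-inv df
  ... | τ-post , _ , _ , _ , _ , res-get≤ , β≤pre-get
    with set-f-then-call-inv (EffArrow-mono τ-post (valTy-mono τ≤ρf)) dcont
       | set-clause-inv dset | get-clause-inv dget
  ... | f≤arg-set , post-get≤pre-set | u , r , pre-set≤u⟶r , arg-set≤u
      | σ , ρ , σ⟶ρ≤post-get , σ≤res-get , _ , _ , pre-get≤ , σ≤u' =
    state-absurd (EffArrow-mono τ-post (≤ᵗ-trans (valTy-mono τ≤ρf) f≤σ))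
    where
    u≤σ : u ≤ᵗ σ
    u≤σ with ≤ᵗ-trans σ⟶ρ≤post-get (≤ᵗ-trans (valTy-mono post-get≤pre-set) pre-set≤u⟶r)
    ... | arr u≤σ _ = u≤σ

    f≤σ : valTy ρf ≤ᵗ σ
    f≤σ = ≤ᵗ-trans f≤arg-set (≤ᵗ-trans arg-set≤u u≤σ)

    state-absurd : EffArrow post-get σ → ⊥
    state-absurd (effArrow {β = Q} post-get≤Q) =
      no-arrow-fed-to-own-post
        (≤ᵗ-trans σ⟶ρ≤post-get (valTy-mono post-get≤Q))
        (≤ᵗ-trans (valTy-mono Q≤pre-get) pre-get≤)
        σ≤u'
      where
      Q≤pre-get : Q ≤ʳ pre-get
      Q≤pre-get = ≤ʳ-trans (⟶-post-≤ (≤ᵗ-trans σ≤res-get res-get≤)) β≤pre-get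

mainTheorem6 :
    NoRecC c-ex5
    × (∀ (S : SSig) → S get ≡ (sunit , σt) → S set ≡ (σt , sunit) →
         ∃ λ (σ : STy) → S ∣ [] ⊢ˢᶜ c-ex5 ∶ σ)
    × Diverges c-ex5
    × (∀ (A : ASig) (τ : ATy) → ¬ (A ∣ [] ⊢ᵃᶜ c-ex5 ∶ (τ /□)))
mainTheorem6 =
  c-ex5-noRec ,
  (λ S Sget Sset → sunit , SimpleTyping.c-ex5-⊢ˢ S Sget Sset) ,
  c-ex5-diverges ,
  NotATMTypable.c-ex5-not-typable
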